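{- Let $p=2m+1$ be an odd prime and let $a$ be a positive integer with $\gcd(a,p)=1$. Then the quotient $q$ in $a^{p-1}=qp+1$ is given by \[ q=\frac{a^{p-1}-1}{p}=\frac1a\sum_{k=1}^m\frac{1}{p-2k}\binom{p-k-1}{k}\sum_{j=1}^{a-1}j^k(j+1)^k\in\mathbb{N}, \] and also \[ q=\frac{1}{a(2m+1)}\sum_{j=1}^{a-1}\left({}_2F_1\!\left(-m-\tfrac12,-m;-2m;-4j(j+1)\right)-1\right). \]
   Context: Here ${}_2F_1(-m-\tfrac12,-m;-2m;z)$ denotes the terminating series $\sum_{k=0}^{m}\frac{(-m-\frac12)^{\overline{k}}(-m)^{\overline{k}}}{(-2m)^{\overline{k}}\,k!}z^k$, where $x^{\overline{k}}=x(x+1)\cdots(x+k-1)$ is the rising factorial. -}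

module Defs where

open import Data.Nat as ℕ using (ℕ; zero; suc; _!)
open import Data.Nat.Combinatorics using (_C_)
open import Data.Integer using (+_)
open import Data.Rational using (ℚ; 0ℚ; 1ℚ; ½; _+_; _*_; _-_; -_; 1/_; ≢-nonZero)
open import Data.Rational.Properties using (_≟_)
open import Relation.Nullary using (yes; no)

⟦_⟧ : ℕ → ℚ
⟦ n ⟧ = (+ n) Data.Rational./ 1

-- total division on ℚ (convention x ⊘ 0 = 0; only ever applied to
-- nonzero denominators in the statement)
infixl 7 _⊘_
_⊘_ : ℚ → ℚ → ℚ
x ⊘ y with y ≟ 0ℚ
... | yes _ = 0ℚ
... | no y≢0 = x * (1/_ y {{≢-nonZero y≢0}})

infixr 8 _^ℚ_
_^ℚ_ : ℚ → ℕ → ℚ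
x ^ℚ zero = 1ℚ
x ^ℚ suc n = x * x ^ℚ n

Σ₁ : ℕ → (ℕ → ℚ) → ℚ
Σ₁ zero f = 0ℚ
Σ₁ (suc n) f = Σ₁ n f + f (suc n)

Σ₀ : ℕ → (ℕ → ℚ) → ℚ
Σ₀ n f = f 0 + Σ₁ n f

rising : ℚ → ℕ → ℚ
rising x zero = 1ℚ
rising x (suc k) = rising x k * (x + ⟦ k ⟧)

₂F₁[_,_,_]-upTo_at_ : ℚ → ℚ → ℚ → ℕ → ℚ → ℚ
₂F₁[ a , b , c ]-upTo n at z =
  Σ₀ n (λ k → (rising a k * rising b k) ⊘ (rising c k * ⟦ k ! ⟧) * z ^ℚ k)

{-# OPTIONS --safe #-}
module Submission where

-- With P = j (j + 1), the numbers j + 1 and -j are the two roots of t² = t + P, so for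
-- p = 2m + 1 the difference (j + 1)^p - j^p is a value of a Lucas polynomial in P, namely
-- 1 + Σ_{k=1}^m e_k P^k with e_k = p / (p - 2k) · C(p - k - 1, k).  Summing over
-- j = 1, ..., a - 1 telescopes to a^p - a = a (a^(p-1) - 1).  Since (p - 2k) e_k = p C(p - k - 1, k)
-- and 0 < p - 2k < p, a prime p divides every e_k; together with p ∤ a this gives Fermat's
-- theorem and the binomial formula for q.  Writing the rising factorials of -m - ½, -m and -2m
-- as quotients of factorials shows that the k-th term of the ₂F₁ series at -4P is exactly
-- e_k P^k, which gives the hypergeometric formula.

open import Defs
open import Data.Nat using (ℕ; _+_; _*_; _∸_; _^_; _≥_)
open import Data.Nat.GCD using (gcd)
open import Data.Nat.Primality using (Prime)
open import Data.Nat.Combinatorics using (_C_)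
open import Data.Product using (∃; _×_; _,_)
open import Relation.Binary.PropositionalEquality using (_≡_)
open import Data.Rational using (ℚ; ½; 1ℚ; -_; _-_) renaming (_+_ to _+ℚ_; _*_ to _*ℚ_)

open import Data.Nat using (zero; suc; _!; _≤_; _<_; z≤n; s≤s; nonTrivial⇒≢1)
import Data.Nat.Properties as ℕP
open import Data.Nat.Properties using (_!*_!≢0)
open import Data.Nat.Combinatorics using (nCk+nC[k+1]≡[n+1]C[k+1]; k>n⇒nCk≡0; nCk≡n!/k![n-k]!; k![n∸k]!∣n!)
import Data.Nat.Coprimality as Coprimality
open import Data.Nat.DivMod using (m/n*n≡m)
open import Data.Nat.Divisibility using (_∣_; _∣0; ∣m∣n⇒∣m+n; divides; ∣⇒≤; ∣m⇒∣m*n; ∣1⇒≡1; ∣-refl)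
open import Data.Nat.GCD using (gcd-greatest)
open import Data.Nat.Primality using (euclidsLemma; prime⇒nonTrivial)
open import Data.Nat.Tactic.RingSolver using (solve-∀)
import Data.Integer as ℤ
import Data.Integer.Properties as ℤP
import Data.Integer.Tactic.RingSolver as ℤ-Solver
open import Data.Rational using (0ℚ; mkℚ; 1/_; ≢-nonZero)
import Data.Rational.Properties as ℚP
open import Data.Empty using (⊥-elim)
open import Data.Sum using (inj₁; inj₂)
open import Level using (0ℓ)
open import Relation.Binary.PropositionalEquality
  using (_≢_; refl; sym; trans; cong; cong₂; subst; module ≡-Reasoning)
open import Relation.Nullary using (yes; no)
open import Relation.Nullary.Decidable using (dec⇒maybe)
import Tactic.RingSolver as ℚ-Solver
open import Tactic.RingSolver.Core.AlmostCommutativeRing using (AlmostCommutativeRing; fromCommutativeRing)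

ℚ-ring : AlmostCommutativeRing 0ℓ 0ℓ
ℚ-ring = fromCommutativeRing ℚP.+-*-commutativeRing (λ x → dec⇒maybe (0ℚ ℚP.≟ x))

⟦⟧≡mkℚ : ∀ n → ⟦ n ⟧ ≡ mkℚ (ℤ.+ n) 0 (Coprimality.sym (Coprimality.1-coprimeTo n))
⟦⟧≡mkℚ n = ℚP.normalize-coprime (Coprimality.sym (Coprimality.1-coprimeTo n))

⟦⟧-homo-+ : ∀ m n → ⟦ m + n ⟧ ≡ ⟦ m ⟧ +ℚ ⟦ n ⟧
⟦⟧-homo-+ m n = begin
  ⟦ m + n ⟧
    ≡⟨ cong (Data.Rational._/ 1) (cong₂ ℤ._+_ (sym (ℤP.*-identityʳ (ℤ.+ m))) (sym (ℤP.*-identityʳ (ℤ.+ n)))) ⟩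
  (ℤ.+ m ℤ.* ℤ.+ 1 ℤ.+ ℤ.+ n ℤ.* ℤ.+ 1) Data.Rational./ 1
    ≡⟨ sym (cong₂ _+ℚ_ (⟦⟧≡mkℚ m) (⟦⟧≡mkℚ n)) ⟩
  ⟦ m ⟧ +ℚ ⟦ n ⟧ ∎
  where open ≡-Reasoning

⟦⟧-homo-* : ∀ m n → ⟦ m * n ⟧ ≡ ⟦ m ⟧ *ℚ ⟦ n ⟧
⟦⟧-homo-* m n = begin
  ⟦ m * n ⟧                       ≡⟨ cong (Data.Rational._/ 1) (ℤP.pos-* m n) ⟩
  (ℤ.+ m ℤ.* ℤ.+ n) Data.Rational./ 1 ≡⟨ sym (cong₂ _*ℚ_ (⟦⟧≡mkℚ m) (⟦⟧≡mkℚ n)) ⟩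
  ⟦ m ⟧ *ℚ ⟦ n ⟧                  ∎
  where open ≡-Reasoning

⟦⟧-homo-^ : ∀ m k → ⟦ m ^ k ⟧ ≡ ⟦ m ⟧ ^ℚ k
⟦⟧-homo-^ m zero    = refl
⟦⟧-homo-^ m (suc k) = trans (⟦⟧-homo-* m (m ^ k)) (cong (⟦ m ⟧ *ℚ_) (⟦⟧-homo-^ m k))

⟦⟧-injective : ∀ {m n} → ⟦ m ⟧ ≡ ⟦ n ⟧ → m ≡ n
⟦⟧-injective {m} {n} eq =
  ℤP.+-injective (cong ℚ.numerator (trans (sym (⟦⟧≡mkℚ m)) (trans eq (⟦⟧≡mkℚ n))))

⟦⟧-≢0 : ∀ {n} → n ≢ 0 → ⟦ n ⟧ ≢ 0ℚ
⟦⟧-≢0 n≢0 eq = n≢0 (⟦⟧-injective eq)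

⟦n!⟧≢0 : ∀ n → ⟦ n ! ⟧ ≢ 0ℚ
⟦n!⟧≢0 n = ⟦⟧-≢0 {n !} (ℕP.>⇒≢ (ℕP.1≤n! n))

^ℚ-distribʳ-* : ∀ x y k → (x *ℚ y) ^ℚ k ≡ x ^ℚ k *ℚ y ^ℚ k
^ℚ-distribʳ-* x y zero    = refl
^ℚ-distribʳ-* x y (suc k) =
  trans (cong ((x *ℚ y) *ℚ_) (^ℚ-distribʳ-* x y k)) (interchange x y (x ^ℚ k) (y ^ℚ k))
  where
  interchange : ∀ x y u v → (x *ℚ y) *ℚ (u *ℚ v) ≡ (x *ℚ u) *ℚ (y *ℚ v)
  interchange = ℚ-Solver.solve-∀ ℚ-ring

1⊘y*y≡1 : ∀ y → y ≢ 0ℚ → (1ℚ ⊘ y) *ℚ y ≡ 1ℚ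
1⊘y*y≡1 y y≢0 with y ℚP.≟ 0ℚ
... | yes y≡0 = ⊥-elim (y≢0 y≡0)
... | no y≢0′ = trans (cong (_*ℚ y) (ℚP.*-identityˡ (1/ y))) (ℚP.*-inverseˡ y)
  where instance _ = ≢-nonZero y≢0′

⊘-*-comm : ∀ x y w → (x ⊘ y) *ℚ w ≡ (x *ℚ w) ⊘ y
⊘-*-comm x y w with y ℚP.≟ 0ℚ
... | yes _   = ℚP.*-zeroˡ w
... | no y≢0′ = swap x (1/ y) w
  where
  instance _ = ≢-nonZero y≢0′
  swap : ∀ x u w → x *ℚ u *ℚ w ≡ x *ℚ w *ℚ u
  swap = ℚ-Solver.solve-∀ ℚ-ring

x≡z*y⇒x⊘y≡z : ∀ x y z → y ≢ 0ℚ → x ≡ z *ℚ y → x ⊘ y ≡ z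
x≡z*y⇒x⊘y≡z x y z y≢0 refl with y ℚP.≟ 0ℚ
... | yes y≡0 = ⊥-elim (y≢0 y≡0)
... | no y≢0′ = begin
  z *ℚ y *ℚ (1/ y)   ≡⟨ ℚP.*-assoc z y (1/ y) ⟩
  z *ℚ (y *ℚ (1/ y)) ≡⟨ cong (z *ℚ_) (ℚP.*-inverseʳ y) ⟩
  z *ℚ 1ℚ            ≡⟨ ℚP.*-identityʳ z ⟩
  z                  ∎
  where
  open ≡-Reasoning
  instance _ = ≢-nonZero y≢0′

1⊘y*[z*y]≡z : ∀ y z → y ≢ 0ℚ → (1ℚ ⊘ y) *ℚ (z *ℚ y) ≡ z
1⊘y*[z*y]≡z y z y≢0 = trans (⊘-*-comm 1ℚ y (z *ℚ y))
                            (trans (cong (_⊘ y) (ℚP.*-identityˡ (z *ℚ y))) (x≡z*y⇒x⊘y≡z (z *ℚ y) y z y≢0 refl))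

*-cancelʳ-≡ : ∀ x y u → u ≢ 0ℚ → x *ℚ u ≡ y *ℚ u → x ≡ y
*-cancelʳ-≡ x y u u≢0 eq =
  trans (sym (x≡z*y⇒x⊘y≡z (x *ℚ u) u x u≢0 refl)) (x≡z*y⇒x⊘y≡z (x *ℚ u) u y u≢0 eq)

x*y≢0 : ∀ x y → x ≢ 0ℚ → y ≢ 0ℚ → x *ℚ y ≢ 0ℚ
x*y≢0 x y x≢0 y≢0 eq = x≢0 (*-cancelʳ-≡ x 0ℚ y y≢0 (trans eq (sym (ℚP.*-zeroˡ y))))

x^k≢0 : ∀ x k → x ≢ 0ℚ → x ^ℚ k ≢ 0ℚ
x^k≢0 x zero    x≢0 = λ ()
x^k≢0 x (suc k) x≢0 = x*y≢0 x (x ^ℚ k) x≢0 (x^k≢0 x k x≢0)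

1⊘⟦n⟧*⟦m*n⟧≡⟦m⟧ : ∀ m n → n ≢ 0 → (1ℚ ⊘ ⟦ n ⟧) *ℚ ⟦ m * n ⟧ ≡ ⟦ m ⟧
1⊘⟦n⟧*⟦m*n⟧≡⟦m⟧ m n n≢0 = trans (cong ((1ℚ ⊘ ⟦ n ⟧) *ℚ_) (⟦⟧-homo-* m n)) (1⊘y*[z*y]≡z ⟦ n ⟧ ⟦ m ⟧ (⟦⟧-≢0 n≢0))

⊘-cross : ∀ a b c d → a ≢ 0 → b ≢ 0 → a * d ≡ b * c → (1ℚ ⊘ ⟦ a ⟧) *ℚ ⟦ c ⟧ ≡ (1ℚ ⊘ ⟦ b ⟧) *ℚ ⟦ d ⟧
⊘-cross a b c d a≢0 b≢0 ad≡bc = begin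
  u *ℚ ⟦ c ⟧                    ≡⟨ sym (ℚP.*-identityʳ _) ⟩
  u *ℚ ⟦ c ⟧ *ℚ 1ℚ              ≡⟨ cong (u *ℚ ⟦ c ⟧ *ℚ_) (sym (1⊘y*y≡1 ⟦ b ⟧ (⟦⟧-≢0 b≢0))) ⟩
  u *ℚ ⟦ c ⟧ *ℚ (v *ℚ ⟦ b ⟧)    ≡⟨ regroup u ⟦ c ⟧ v ⟦ b ⟧ ⟩
  u *ℚ v *ℚ (⟦ b ⟧ *ℚ ⟦ c ⟧)    ≡⟨ cong (u *ℚ v *ℚ_) (trans (sym (⟦⟧-homo-* b c)) (trans (cong ⟦_⟧ (sym ad≡bc)) (⟦⟧-homo-* a d))) ⟩
  u *ℚ v *ℚ (⟦ a ⟧ *ℚ ⟦ d ⟧)    ≡⟨ interchange u v ⟦ a ⟧ ⟦ d ⟧ ⟩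
  (u *ℚ ⟦ a ⟧) *ℚ (v *ℚ ⟦ d ⟧)  ≡⟨ cong (_*ℚ (v *ℚ ⟦ d ⟧)) (1⊘y*y≡1 ⟦ a ⟧ (⟦⟧-≢0 a≢0)) ⟩
  1ℚ *ℚ (v *ℚ ⟦ d ⟧)            ≡⟨ ℚP.*-identityˡ _ ⟩
  v *ℚ ⟦ d ⟧                    ∎
  where
  open ≡-Reasoning
  u v : ℚ
  u = 1ℚ ⊘ ⟦ a ⟧
  v = 1ℚ ⊘ ⟦ b ⟧
  regroup : ∀ u c v b → u *ℚ c *ℚ (v *ℚ b) ≡ u *ℚ v *ℚ (b *ℚ c)
  regroup = ℚ-Solver.solve-∀ ℚ-ring
  interchange : ∀ u v a d → u *ℚ v *ℚ (a *ℚ d) ≡ (u *ℚ a) *ℚ (v *ℚ d)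
  interchange = ℚ-Solver.solve-∀ ℚ-ring

sum₁ : ℕ → (ℕ → ℕ) → ℕ
sum₁ zero    f = 0
sum₁ (suc n) f = sum₁ n f + f (suc n)

sum< : ℕ → (ℕ → ℕ) → ℕ
sum< zero    f = 0
sum< (suc n) f = f 0 + sum< n (λ i → f (suc i))

sum₁-cong : ∀ n {f g} → (∀ i → 1 ≤ i → i ≤ n → f i ≡ g i) → sum₁ n f ≡ sum₁ n g
sum₁-cong zero    f≗g = refl
sum₁-cong (suc n) f≗g =
  cong₂ _+_ (sum₁-cong n (λ i 1≤i i≤n → f≗g i 1≤i (ℕP.m≤n⇒m≤1+n i≤n))) (f≗g (suc n) (s≤s z≤n) ℕP.≤-refl)

sum₁-distrib-+ : ∀ n f g → sum₁ n (λ i → f i + g i) ≡ sum₁ n f + sum₁ n g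
sum₁-distrib-+ zero    f g = refl
sum₁-distrib-+ (suc n) f g =
  trans (cong (_+ (f (suc n) + g (suc n))) (sum₁-distrib-+ n f g)) (interchange (sum₁ n f) (sum₁ n g) _ _)
  where
  interchange : ∀ a b c d → a + b + (c + d) ≡ a + c + (b + d)
  interchange = solve-∀

sum₁-*ˡ : ∀ n c f → sum₁ n (λ i → c * f i) ≡ c * sum₁ n f
sum₁-*ˡ zero    c f = sym (ℕP.*-zeroʳ c)
sum₁-*ˡ (suc n) c f = trans (cong (_+ c * f (suc n)) (sum₁-*ˡ n c f)) (sym (ℕP.*-distribˡ-+ c _ _))

sum₁-zero : ∀ n → sum₁ n (λ _ → 0) ≡ 0
sum₁-zero zero    = refl
sum₁-zero (suc n) = trans (ℕP.+-identityʳ _) (sum₁-zero n)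

sum₁-comm : ∀ m n (f : ℕ → ℕ → ℕ) → sum₁ m (λ i → sum₁ n (f i)) ≡ sum₁ n (λ k → sum₁ m (λ i → f i k))
sum₁-comm zero    n f = sym (sum₁-zero n)
sum₁-comm (suc m) n f = trans (cong (_+ sum₁ n (f (suc m))) (sum₁-comm m n f))
                              (sym (sum₁-distrib-+ n (λ k → sum₁ m (λ i → f i k)) (f (suc m))))

sum₁-vanishing : ∀ m n f → (∀ i → f (suc (m + i)) ≡ 0) → sum₁ (m + n) f ≡ sum₁ m f
sum₁-vanishing m zero    f f≡0 = cong (λ k → sum₁ k f) (ℕP.+-identityʳ m)
sum₁-vanishing m (suc n) f f≡0 rewrite ℕP.+-suc m n =
  trans (cong₂ _+_ (sum₁-vanishing m n f f≡0) (f≡0 n)) (ℕP.+-identityʳ (sum₁ m f))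

∣-sum₁ : ∀ {d} n f → (∀ i → 1 ≤ i → i ≤ n → d ∣ f i) → d ∣ sum₁ n f
∣-sum₁ zero    f d∣f = _ ∣0
∣-sum₁ (suc n) f d∣f =
  ∣m∣n⇒∣m+n (∣-sum₁ n f (λ i 1≤i i≤n → d∣f i 1≤i (ℕP.m≤n⇒m≤1+n i≤n))) (d∣f (suc n) (s≤s z≤n) ℕP.≤-refl)

sum<-suc : ∀ n f → sum< (suc n) f ≡ sum< n f + f n
sum<-suc zero    f = ℕP.+-comm (f 0) 0
sum<-suc (suc n) f = trans (cong (f 0 +_) (sum<-suc n (λ i → f (suc i)))) (sym (ℕP.+-assoc (f 0) _ _))

sum<-distrib-+ : ∀ n f g → sum< n (λ i → f i + g i) ≡ sum< n f + sum< n g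
sum<-distrib-+ zero    f g = refl
sum<-distrib-+ (suc n) f g =
  trans (cong (f 0 + g 0 +_) (sum<-distrib-+ n _ _)) (interchange (f 0) (g 0) _ _)
  where
  interchange : ∀ a b c d → a + b + (c + d) ≡ a + c + (b + d)
  interchange = solve-∀

sum<-*ˡ : ∀ n c f → sum< n (λ i → c * f i) ≡ c * sum< n f
sum<-*ˡ zero    c f = sym (ℕP.*-zeroʳ c)
sum<-*ˡ (suc n) c f = trans (cong (c * f 0 +_) (sum<-*ˡ n c _)) (sym (ℕP.*-distribˡ-+ c _ _))

sum<-cong : ∀ n {f g} → (∀ i → f i ≡ g i) → sum< n f ≡ sum< n g
sum<-cong zero    f≗g = refl
sum<-cong (suc n) f≗g = cong₂ _+_ (f≗g 0) (sum<-cong n (λ i → f≗g (suc i)))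

sum₁≡sum< : ∀ n f → sum₁ n f ≡ sum< n (λ i → f (suc i))
sum₁≡sum< zero    f = refl
sum₁≡sum< (suc n) f = trans (cong (_+ f (suc n)) (sum₁≡sum< n f)) (sym (sum<-suc n (λ i → f (suc i))))

Σ₁-cong : ∀ n {f g} → (∀ i → 1 ≤ i → i ≤ n → f i ≡ g i) → Σ₁ n f ≡ Σ₁ n g
Σ₁-cong zero    f≗g = refl
Σ₁-cong (suc n) f≗g =
  cong₂ _+ℚ_ (Σ₁-cong n (λ i 1≤i i≤n → f≗g i 1≤i (ℕP.m≤n⇒m≤1+n i≤n))) (f≗g (suc n) (s≤s z≤n) ℕP.≤-refl)

Σ₁-*ˡ : ∀ n c f → Σ₁ n (λ i → c *ℚ f i) ≡ c *ℚ Σ₁ n f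
Σ₁-*ˡ zero    c f = sym (ℚP.*-zeroʳ c)
Σ₁-*ˡ (suc n) c f = trans (cong (_+ℚ c *ℚ f (suc n)) (Σ₁-*ˡ n c f)) (sym (ℚP.*-distribˡ-+ c _ _))

Σ₁-⟦⟧ : ∀ n f → Σ₁ n (λ i → ⟦ f i ⟧) ≡ ⟦ sum₁ n f ⟧
Σ₁-⟦⟧ zero    f = refl
Σ₁-⟦⟧ (suc n) f = trans (cong (_+ℚ ⟦ f (suc n) ⟧) (Σ₁-⟦⟧ n f)) (sym (⟦⟧-homo-+ (sum₁ n f) (f (suc n))))

-- Jacobsthal and Lucas polynomials

pascal-∸ : ∀ n i → (suc n ∸ i) C suc i ≡ (n ∸ i) C i + (n ∸ i) C suc i
pascal-∸ n zero = sym (nCk+nC[k+1]≡[n+1]C[k+1] n 0)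
pascal-∸ n (suc i) with suc i ℕP.≤? n
... | yes i<n = trans (cong (_C suc (suc i)) (ℕP.+-∸-assoc 1 i<n))
                      (sym (nCk+nC[k+1]≡[n+1]C[k+1] (n ∸ suc i) (suc i)))
... | no i≮n rewrite ℕP.m≤n⇒m∸n≡0 (ℕP.≤-pred (ℕP.≰⇒> i≮n))
                   | ℕP.m≤n⇒m∸n≡0 (ℕP.m≤n⇒m≤1+n (ℕP.≤-pred (ℕP.≰⇒> i≮n))) = refl

jacobsthalTerm : ℕ → ℕ → ℕ → ℕ
jacobsthalTerm P n i = ((n ∸ i) C i) * P ^ i

jacobsthal : ℕ → ℕ → ℕ
jacobsthal P n = sum< (suc n) (jacobsthalTerm P n)

jacobsthal-rec : ∀ P n → jacobsthal P (2 + n) ≡ jacobsthal P (1 + n) + P * jacobsthal P n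
jacobsthal-rec P n = begin
  1 + sum< (2 + n) (λ i → j₂ (suc i))
    ≡⟨ cong (1 +_) (sum<-cong (2 + n) pascal-term) ⟩
  1 + sum< (2 + n) (λ i → P * j₀ i + j₁ (suc i))
    ≡⟨ cong (1 +_) (sum<-distrib-+ (2 + n) (λ i → P * j₀ i) (λ i → j₁ (suc i))) ⟩
  1 + (sum< (2 + n) (λ i → P * j₀ i) + sum< (2 + n) (λ i → j₁ (suc i)))
    ≡⟨ cong (λ x → 1 + (x + sum< (2 + n) (λ i → j₁ (suc i)))) (sum<-*ˡ (2 + n) P j₀) ⟩
  1 + (P * sum< (2 + n) j₀ + sum< (2 + n) (λ i → j₁ (suc i)))
    ≡⟨ cong₂ (λ x y → 1 + (P * x + y)) (sum<-suc (suc n) j₀) (sum<-suc (suc n) (λ i → j₁ (suc i))) ⟩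
  1 + (P * (jacobsthal P n + j₀ (suc n)) + (sum< (suc n) (λ i → j₁ (suc i)) + j₁ (2 + n)))
    ≡⟨ cong₂ (λ x y → 1 + (P * (jacobsthal P n + (x C suc n) * P ^ suc n)
                                  + (sum< (suc n) (λ i → j₁ (suc i)) + (y C (2 + n)) * P ^ (2 + n))))
             (n∸1+n≡0 n) (n∸1+n≡0 n) ⟩
  1 + (P * (jacobsthal P n + 0) + (sum< (suc n) (λ i → j₁ (suc i)) + 0))
    ≡⟨ rearrange P (jacobsthal P n) (sum< (suc n) (λ i → j₁ (suc i))) ⟩
  jacobsthal P (1 + n) + P * jacobsthal P n ∎
  where
  open ≡-Reasoning
  j₀ j₁ j₂ : ℕ → ℕ
  j₀ = jacobsthalTerm P n
  j₁ = jacobsthalTerm P (1 + n)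
  j₂ = jacobsthalTerm P (2 + n)
  n∸1+n≡0 : ∀ n → n ∸ suc n ≡ 0
  n∸1+n≡0 n = ℕP.m≤n⇒m∸n≡0 (ℕP.n≤1+n n)
  rearrange : ∀ P s t → 1 + (P * (s + 0) + (t + 0)) ≡ (1 + t) + P * s
  rearrange = solve-∀
  distribute : ∀ a b P Q → (a + b) * (P * Q) ≡ P * (a * Q) + b * (P * Q)
  distribute = solve-∀
  pascal-term : ∀ i → j₂ (suc i) ≡ P * j₀ i + j₁ (suc i)
  pascal-term i = trans (cong (_* (P * P ^ i)) (pascal-∸ n i)) (distribute ((n ∸ i) C i) ((n ∸ i) C suc i) P (P ^ i))

root-pow : ∀ t P → t ℤ.* t ≡ t ℤ.+ ℤ.+ P → ∀ n →
           t ℤ.^ (2 + n) ≡ ℤ.+ jacobsthal P (suc n) ℤ.* t ℤ.+ ℤ.+ P ℤ.* ℤ.+ jacobsthal P n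
root-pow t P root zero = trans (cong (t ℤ.*_) (ℤP.*-identityʳ t)) (trans root (base t (ℤ.+ P)))
  where
  base : ∀ t P → t ℤ.+ P ≡ ℤ.1ℤ ℤ.* t ℤ.+ P ℤ.* ℤ.1ℤ
  base = ℤ-Solver.solve-∀
root-pow t P root (suc n) = begin
  t ℤ.* t ℤ.^ (2 + n)                       ≡⟨ cong (t ℤ.*_) (root-pow t P root n) ⟩
  t ℤ.* (a ℤ.* t ℤ.+ ℤ.+ P ℤ.* b)           ≡⟨ expand t a (ℤ.+ P) b ⟩
  a ℤ.* (t ℤ.* t) ℤ.+ ℤ.+ P ℤ.* b ℤ.* t     ≡⟨ cong (λ x → a ℤ.* x ℤ.+ ℤ.+ P ℤ.* b ℤ.* t) root ⟩
  a ℤ.* (t ℤ.+ ℤ.+ P) ℤ.+ ℤ.+ P ℤ.* b ℤ.* t ≡⟨ collect t a (ℤ.+ P) b ⟩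
  (a ℤ.+ ℤ.+ P ℤ.* b) ℤ.* t ℤ.+ ℤ.+ P ℤ.* a ≡⟨ cong (λ x → x ℤ.* t ℤ.+ ℤ.+ P ℤ.* a) (sym recurrence) ⟩
  ℤ.+ jacobsthal P (2 + n) ℤ.* t ℤ.+ ℤ.+ P ℤ.* a ∎
  where
  open ≡-Reasoning
  a b : ℤ.ℤ
  a = ℤ.+ jacobsthal P (suc n)
  b = ℤ.+ jacobsthal P n
  recurrence : ℤ.+ jacobsthal P (2 + n) ≡ a ℤ.+ ℤ.+ P ℤ.* b
  recurrence = trans (cong ℤ.+_ (jacobsthal-rec P n))
                     (trans (ℤP.pos-+ (jacobsthal P (suc n)) _) (cong (λ x → a ℤ.+ x) (ℤP.pos-* P (jacobsthal P n))))
  expand : ∀ t a P b → t ℤ.* (a ℤ.* t ℤ.+ P ℤ.* b) ≡ a ℤ.* (t ℤ.* t) ℤ.+ P ℤ.* b ℤ.* t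
  expand = ℤ-Solver.solve-∀
  collect : ∀ t a P b → a ℤ.* (t ℤ.+ P) ℤ.+ P ℤ.* b ℤ.* t ≡ (a ℤ.+ P ℤ.* b) ℤ.* t ℤ.+ P ℤ.* a
  collect = ℤ-Solver.solve-∀

roots-power-sum : ∀ t u P → t ℤ.+ u ≡ ℤ.1ℤ → t ℤ.* u ≡ ℤ.- ℤ.+ P → ∀ n →
                  t ℤ.^ (2 + n) ℤ.+ u ℤ.^ (2 + n) ≡ ℤ.+ (jacobsthal P (suc n) + 2 * (P * jacobsthal P n))
roots-power-sum t u P t+u≡1 tu≡-P n = begin
  t ℤ.^ (2 + n) ℤ.+ u ℤ.^ (2 + n)
    ≡⟨ cong₂ ℤ._+_ (root-pow t P (is-root t u t+u≡1 tu≡-P) n)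
                   (root-pow u P (is-root u t (trans (ℤP.+-comm u t) t+u≡1) (trans (ℤP.*-comm u t) tu≡-P)) n) ⟩
  a ℤ.* t ℤ.+ ℤ.+ P ℤ.* b ℤ.+ (a ℤ.* u ℤ.+ ℤ.+ P ℤ.* b) ≡⟨ collect a t u (ℤ.+ P) b ⟩
  a ℤ.* (t ℤ.+ u) ℤ.+ ℤ.+ 2 ℤ.* (ℤ.+ P ℤ.* b)          ≡⟨ cong (λ x → a ℤ.* x ℤ.+ ℤ.+ 2 ℤ.* (ℤ.+ P ℤ.* b)) t+u≡1 ⟩
  a ℤ.* ℤ.1ℤ ℤ.+ ℤ.+ 2 ℤ.* (ℤ.+ P ℤ.* b)               ≡⟨ cong (λ x → x ℤ.+ ℤ.+ 2 ℤ.* (ℤ.+ P ℤ.* b)) (ℤP.*-identityʳ a) ⟩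
  a ℤ.+ ℤ.+ 2 ℤ.* (ℤ.+ P ℤ.* b)                        ≡⟨ sym cast ⟩
  ℤ.+ (jacobsthal P (suc n) + 2 * (P * jacobsthal P n)) ∎
  where
  open ≡-Reasoning
  a b : ℤ.ℤ
  a = ℤ.+ jacobsthal P (suc n)
  b = ℤ.+ jacobsthal P n
  is-root : ∀ x y → x ℤ.+ y ≡ ℤ.1ℤ → x ℤ.* y ≡ ℤ.- ℤ.+ P → x ℤ.* x ≡ x ℤ.+ ℤ.+ P
  is-root x y x+y≡1 xy≡-P = begin
    x ℤ.* x                          ≡⟨ vieta x y ⟩
    x ℤ.* (x ℤ.+ y) ℤ.- x ℤ.* y      ≡⟨ cong₂ (λ s p → x ℤ.* s ℤ.- p) x+y≡1 xy≡-P ⟩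
    x ℤ.* ℤ.1ℤ ℤ.- ℤ.- ℤ.+ P         ≡⟨ simplify x (ℤ.+ P) ⟩
    x ℤ.+ ℤ.+ P                      ∎
    where
    vieta : ∀ x y → x ℤ.* x ≡ x ℤ.* (x ℤ.+ y) ℤ.- x ℤ.* y
    vieta = ℤ-Solver.solve-∀
    simplify : ∀ x P → x ℤ.* ℤ.1ℤ ℤ.- ℤ.- P ≡ x ℤ.+ P
    simplify = ℤ-Solver.solve-∀
  collect : ∀ a t u P b → a ℤ.* t ℤ.+ P ℤ.* b ℤ.+ (a ℤ.* u ℤ.+ P ℤ.* b) ≡ a ℤ.* (t ℤ.+ u) ℤ.+ ℤ.+ 2 ℤ.* (P ℤ.* b)
  collect = ℤ-Solver.solve-∀
  cast : ℤ.+ (jacobsthal P (suc n) + 2 * (P * jacobsthal P n)) ≡ a ℤ.+ ℤ.+ 2 ℤ.* (ℤ.+ P ℤ.* b)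
  cast = trans (ℤP.pos-+ (jacobsthal P (suc n)) _)
               (cong (λ x → a ℤ.+ x) (trans (ℤP.pos-* 2 (P * jacobsthal P n)) (cong (λ x → ℤ.+ 2 ℤ.* x) (ℤP.pos-* P (jacobsthal P n)))))

pos-^ : ∀ a k → ℤ.+ (a ^ k) ≡ (ℤ.+ a) ℤ.^ k
pos-^ a zero    = refl
pos-^ a (suc k) = trans (ℤP.pos-* a (a ^ k)) (cong (λ x → ℤ.+ a ℤ.* x) (pos-^ a k))

-‿^-odd : ∀ x k → (ℤ.- x) ℤ.^ suc (2 * k) ≡ ℤ.- (x ℤ.^ suc (2 * k))
-‿^-odd x k = begin
  (ℤ.- x) ℤ.* (ℤ.- x) ℤ.^ (2 * k)     ≡⟨ cong ((ℤ.- x) ℤ.*_) (sym (ℤP.^-*-assoc (ℤ.- x) 2 k)) ⟩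
  (ℤ.- x) ℤ.* ((ℤ.- x) ℤ.^ 2) ℤ.^ k   ≡⟨ cong (λ y → (ℤ.- x) ℤ.* y ℤ.^ k) (square-neg x) ⟩
  (ℤ.- x) ℤ.* (x ℤ.^ 2) ℤ.^ k         ≡⟨ cong ((ℤ.- x) ℤ.*_) (ℤP.^-*-assoc x 2 k) ⟩
  (ℤ.- x) ℤ.* x ℤ.^ (2 * k)           ≡⟨ sym (ℤP.neg-distribˡ-* x (x ℤ.^ (2 * k))) ⟩
  ℤ.- (x ℤ.* x ℤ.^ (2 * k))           ∎
  where
  open ≡-Reasoning
  square-neg : ∀ x → (ℤ.- x) ℤ.* ((ℤ.- x) ℤ.* ℤ.1ℤ) ≡ x ℤ.* (x ℤ.* ℤ.1ℤ)
  square-neg = ℤ-Solver.solve-∀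

consecutive-powers-jacobsthal : ∀ j m → let P = j * (j + 1); n = 2 * m + 1 in
  (j + 1) ^ (2 * suc m + 1) ≡ j ^ (2 * suc m + 1) + (jacobsthal P (suc n) + 2 * (P * jacobsthal P n))
consecutive-powers-jacobsthal j m = ℤP.+-injective (begin
  ℤ.+ ((j + 1) ^ p)                    ≡⟨ trans (pos-^ (j + 1) p) (cong (ℤ._^ p) (ℤP.pos-+ j 1)) ⟩
  t ℤ.^ p                              ≡⟨ add-sub (t ℤ.^ p) (u ℤ.^ p) ⟩
  t ℤ.^ p ℤ.+ u ℤ.^ p ℤ.- u ℤ.^ p      ≡⟨ cong₂ ℤ._-_ sum-of-powers (odd-power p≡2m+1) ⟩
  ℤ.+ V ℤ.- ℤ.- ((ℤ.+ j) ℤ.^ p)        ≡⟨ swap (ℤ.+ V) ((ℤ.+ j) ℤ.^ p) ⟩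
  (ℤ.+ j) ℤ.^ p ℤ.+ ℤ.+ V              ≡⟨ cong (ℤ._+ ℤ.+ V) (sym (pos-^ j p)) ⟩
  ℤ.+ (j ^ p) ℤ.+ ℤ.+ V                ≡⟨ sym (ℤP.pos-+ (j ^ p) V) ⟩
  ℤ.+ (j ^ p + V)                      ∎)
  where
  open ≡-Reasoning
  p P n V : ℕ
  p = 2 * suc m + 1
  P = j * (j + 1)
  n = 2 * m + 1
  V = jacobsthal P (suc n) + 2 * (P * jacobsthal P n)
  t u : ℤ.ℤ
  t = ℤ.+ j ℤ.+ ℤ.1ℤ
  u = ℤ.- ℤ.+ j
  p≡2+n : p ≡ 2 + n
  p≡2+n = shift m
    where
    shift : ∀ m → 2 * suc m + 1 ≡ 2 + (2 * m + 1)
    shift = solve-∀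
  p≡2m+1 : p ≡ suc (2 * suc m)
  p≡2m+1 = ℕP.+-comm (2 * suc m) 1
  odd-power : ∀ {e} → e ≡ suc (2 * suc m) → u ℤ.^ e ≡ ℤ.- ((ℤ.+ j) ℤ.^ e)
  odd-power refl = -‿^-odd (ℤ.+ j) (suc m)
  sum-of-powers : t ℤ.^ p ℤ.+ u ℤ.^ p ≡ ℤ.+ V
  sum-of-powers = subst (λ e → t ℤ.^ e ℤ.+ u ℤ.^ e ≡ ℤ.+ V) (sym p≡2+n)
                        (roots-power-sum t u P (sum≡1 (ℤ.+ j)) product≡-P n)
    where
    sum≡1 : ∀ x → x ℤ.+ ℤ.1ℤ ℤ.+ ℤ.- x ≡ ℤ.1ℤ
    sum≡1 = ℤ-Solver.solve-∀
    product : ∀ x → (x ℤ.+ ℤ.1ℤ) ℤ.* (ℤ.- x) ≡ ℤ.- (x ℤ.* (x ℤ.+ ℤ.1ℤ))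
    product = ℤ-Solver.solve-∀
    product≡-P : t ℤ.* u ≡ ℤ.- ℤ.+ P
    product≡-P = trans (product (ℤ.+ j))
                       (cong ℤ.-_ (sym (trans (ℤP.pos-* j (j + 1)) (cong (λ x → ℤ.+ j ℤ.* x) (ℤP.pos-+ j 1)))))
  add-sub : ∀ x y → x ≡ x ℤ.+ y ℤ.- y
  add-sub = ℤ-Solver.solve-∀
  swap : ∀ v w → v ℤ.- ℤ.- w ≡ w ℤ.+ v
  swap = ℤ-Solver.solve-∀

-- For k ≥ 1 this is (N + 1) / (N + 1 - 2k) · C(N - k, k), the coefficient of P^k in the
-- Lucas polynomial of index N + 1 (see lucasCoeff-factorial).
lucasCoeff : ℕ → ℕ → ℕ
lucasCoeff N k = (N ∸ k) C k + 2 * ((N ∸ k) C (k ∸ 1))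

lucas-expansion : ∀ P n → jacobsthal P (suc n) + 2 * (P * jacobsthal P n) ≡
                          1 + sum₁ (suc n) (λ k → lucasCoeff (suc n) k * P ^ k)
lucas-expansion P n = begin
  1 + sum< (suc n) (λ i → j₁ (suc i)) + 2 * (P * sum< (suc n) j₀)
    ≡⟨ cong (λ x → 1 + sum< (suc n) (λ i → j₁ (suc i)) + x) (sym scale) ⟩
  1 + sum< (suc n) (λ i → j₁ (suc i)) + sum< (suc n) (λ i → 2 * (P * j₀ i))
    ≡⟨ ℕP.+-assoc 1 (sum< (suc n) (λ i → j₁ (suc i))) (sum< (suc n) (λ i → 2 * (P * j₀ i))) ⟩
  1 + (sum< (suc n) (λ i → j₁ (suc i)) + sum< (suc n) (λ i → 2 * (P * j₀ i)))
    ≡⟨ cong (1 +_) (sym (sum<-distrib-+ (suc n) (λ i → j₁ (suc i)) (λ i → 2 * (P * j₀ i)))) ⟩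
  1 + sum< (suc n) (λ i → j₁ (suc i) + 2 * (P * j₀ i))
    ≡⟨ cong (1 +_) (sum<-cong (suc n) merge) ⟩
  1 + sum< (suc n) (λ i → lucasCoeff (suc n) (suc i) * P ^ suc i)
    ≡⟨ cong (1 +_) (sym (sum₁≡sum< (suc n) (λ k → lucasCoeff (suc n) k * P ^ k))) ⟩
  1 + sum₁ (suc n) (λ k → lucasCoeff (suc n) k * P ^ k) ∎
  where
  open ≡-Reasoning
  j₀ j₁ : ℕ → ℕ
  j₀ = jacobsthalTerm P n
  j₁ = jacobsthalTerm P (suc n)
  scale : sum< (suc n) (λ i → 2 * (P * j₀ i)) ≡ 2 * (P * sum< (suc n) j₀)
  scale = trans (sum<-*ˡ (suc n) 2 (λ i → P * j₀ i)) (cong (2 *_) (sum<-*ˡ (suc n) P j₀))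
  factor : ∀ x y P Q → x * (P * Q) + 2 * (P * (y * Q)) ≡ (x + 2 * y) * (P * Q)
  factor = solve-∀
  merge : ∀ i → j₁ (suc i) + 2 * (P * j₀ i) ≡ lucasCoeff (suc n) (suc i) * P ^ suc i
  merge i = factor ((n ∸ i) C suc i) ((n ∸ i) C i) P (P ^ i)

lucasCoeff-vanishing : ∀ m i → lucasCoeff (2 * suc m) (suc (suc m + i)) ≡ 0
lucasCoeff-vanishing m i =
  cong₂ (λ x y → x + 2 * y) (k>n⇒nCk≡0 (top< (ℕP.n≤1+n _))) (k>n⇒nCk≡0 (top< ℕP.≤-refl))
  where
  double : ∀ m → 2 * suc m ≡ suc m + suc m
  double = solve-∀
  top : 2 * suc m ∸ suc (suc m + i) ≡ m ∸ i
  top = trans (cong₂ _∸_ (double m) (sym (ℕP.+-suc (suc m) i))) (ℕP.[m+n]∸[m+o]≡n∸o (suc m) (suc m) (suc i))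
  top< : ∀ {k} → suc m + i ≤ k → 2 * suc m ∸ suc (suc m + i) < k
  top< {k} le = subst (_< k) (sym top) (ℕP.≤-trans (s≤s (ℕP.m∸n≤m m i)) (ℕP.≤-trans (ℕP.m≤m+n (suc m) i) le))

Δ : ℕ → ℕ → ℕ
Δ m j = sum₁ m (λ k → lucasCoeff (2 * m) k * (j * (j + 1)) ^ k)

consecutive-powers : ∀ m j → (j + 1) ^ (2 * m + 1) ≡ j ^ (2 * m + 1) + (1 + Δ m j)
consecutive-powers zero    j = linear j
  where
  linear : ∀ j → (j + 1) * 1 ≡ j * 1 + (1 + 0)
  linear = solve-∀
consecutive-powers (suc m) j = begin
  (j + 1) ^ p                                                    ≡⟨ consecutive-powers-jacobsthal j m ⟩
  j ^ p + (jacobsthal P (suc n) + 2 * (P * jacobsthal P n))      ≡⟨ cong (j ^ p +_) (lucas-expansion P n) ⟩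
  j ^ p + (1 + sum₁ (suc n) (λ k → lucasCoeff (suc n) k * P ^ k)) ≡⟨ cong (λ x → j ^ p + (1 + x)) truncate ⟩
  j ^ p + (1 + Δ (suc m) j)                                      ∎
  where
  open ≡-Reasoning
  p P n : ℕ
  p = 2 * suc m + 1
  P = j * (j + 1)
  n = 2 * m + 1
  term : ℕ → ℕ
  term k = lucasCoeff (2 * suc m) k * P ^ k
  1+n≡2[1+m] : ∀ m → suc (2 * m + 1) ≡ 2 * suc m
  1+n≡2[1+m] = solve-∀
  double : ∀ m → 2 * suc m ≡ suc m + suc m
  double = solve-∀
  truncate : sum₁ (suc n) (λ k → lucasCoeff (suc n) k * P ^ k) ≡ Δ (suc m) j
  truncate = begin
    sum₁ (suc n) (λ k → lucasCoeff (suc n) k * P ^ k)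
      ≡⟨ cong (λ N → sum₁ N (λ k → lucasCoeff N k * P ^ k)) (1+n≡2[1+m] m) ⟩
    sum₁ (2 * suc m) term
      ≡⟨ cong (λ N → sum₁ N term) (double m) ⟩
    sum₁ (suc m + suc m) term
      ≡⟨ sum₁-vanishing (suc m) (suc m) term (λ i → cong (_* P ^ suc (suc m + i)) (lucasCoeff-vanishing m i)) ⟩
    Δ (suc m) j ∎

telescope : ∀ m J → sum₁ J (Δ m) + suc J ≡ suc J ^ (2 * m + 1)
telescope m zero    = sym (ℕP.^-zeroˡ (2 * m + 1))
telescope m (suc J) = begin
  sum₁ J (Δ m) + Δ m (suc J) + suc (suc J)   ≡⟨ rearrange (sum₁ J (Δ m)) (Δ m (suc J)) J ⟩
  (sum₁ J (Δ m) + suc J) + (1 + Δ m (suc J)) ≡⟨ cong (_+ (1 + Δ m (suc J))) (telescope m J) ⟩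
  suc J ^ p + (1 + Δ m (suc J))              ≡⟨ sym (consecutive-powers m (suc J)) ⟩
  (suc J + 1) ^ p                            ≡⟨ cong (_^ p) (ℕP.+-comm (suc J) 1) ⟩
  suc (suc J) ^ p                            ∎
  where
  open ≡-Reasoning
  p : ℕ
  p = 2 * m + 1
  rearrange : ∀ s d J → s + d + suc (suc J) ≡ (s + suc J) + (1 + d)
  rearrange = solve-∀

-- Lucas coefficients and factorials

nCk*k!*[n∸k]!≡n! : ∀ {n k} → k ≤ n → (n C k) * (k ! * (n ∸ k) !) ≡ n !
nCk*k!*[n∸k]!≡n! {n} {k} k≤n =
  trans (cong (_* (k ! * (n ∸ k) !)) (nCk≡n!/k![n-k]! k≤n)) (m/n*n≡m (k![n∸k]!∣n! k≤n))
  where instance _ = k !* (n ∸ k) !≢0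

[m+n]Cm*m!*n!≡[m+n]! : ∀ m n → ((m + n) C m) * (m ! * n !) ≡ (m + n) !
[m+n]Cm*m!*n!≡[m+n]! m n =
  subst (λ x → ((m + n) C m) * (m ! * x !) ≡ (m + n) !) (ℕP.m+n∸m≡n m n) (nCk*k!*[n∸k]!≡n! (ℕP.m≤m+n m n))

module _ (k s : ℕ) where
  private
    K n N : ℕ
    K = suc k
    n = K + s
    N = K + n

  lucasCoeff-factorial : lucasCoeff N K * (K ! * (suc s) !) ≡ suc N * n !
  lucasCoeff-factorial = begin
    lucasCoeff N K * (K ! * (suc s) !)
      ≡⟨ cong (λ x → (x C K + 2 * (x C k)) * (K ! * (suc s) !)) (ℕP.m+n∸m≡n K n) ⟩
    (c₁ + 2 * c₂) * (K ! * (suc s) !)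
      ≡⟨ expand c₁ c₂ (k !) (s !) k s ⟩
    suc s * (c₁ * (K ! * s !)) + 2 * K * (c₂ * (k ! * (suc s) !))
      ≡⟨ cong₂ (λ x y → suc s * x + 2 * K * y) ([m+n]Cm*m!*n!≡[m+n]! K s) c₂-factorial ⟩
    suc s * n ! + 2 * K * n !
      ≡⟨ collect (n !) k s ⟩
    suc N * n ! ∎
    where
    open ≡-Reasoning
    c₁ c₂ : ℕ
    c₁ = n C K
    c₂ = n C k
    c₂-factorial : c₂ * (k ! * (suc s) !) ≡ n !
    c₂-factorial = subst (λ x → (x C k) * (k ! * (suc s) !) ≡ x !) (ℕP.+-suc k s) ([m+n]Cm*m!*n!≡[m+n]! k (suc s))
    expand : ∀ c₁ c₂ f g k s → (c₁ + 2 * c₂) * ((suc k * f) * (suc s * g)) ≡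
                               suc s * (c₁ * ((suc k * f) * g)) + 2 * suc k * (c₂ * (f * (suc s * g)))
    expand = solve-∀
    collect : ∀ x k s → suc s * x + 2 * suc k * x ≡ suc (suc k + (suc k + s)) * x
    collect = solve-∀

  lucasCoeff-ratio : suc s * lucasCoeff N K ≡ suc N * (n C K)
  lucasCoeff-ratio = ℕP.*-cancelʳ-≡ _ _ (K ! * s !) {{K !* s !≢0}} (begin
    suc s * lucasCoeff N K * (K ! * s !) ≡⟨ shuffle (lucasCoeff N K) (K !) (s !) s ⟩
    lucasCoeff N K * (K ! * (suc s) !)   ≡⟨ lucasCoeff-factorial ⟩
    suc N * n !                          ≡⟨ cong (suc N *_) (sym ([m+n]Cm*m!*n!≡[m+n]! K s)) ⟩
    suc N * ((n C K) * (K ! * s !))      ≡⟨ sym (ℕP.*-assoc (suc N) (n C K) _) ⟩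
    suc N * (n C K) * (K ! * s !)        ∎)
    where
    open ≡-Reasoning
    shuffle : ∀ e f g s → suc s * e * (f * g) ≡ e * (f * (suc s * g))
    shuffle = solve-∀

  prime∣lucasCoeff : Prime (N + 1) → N + 1 ∣ lucasCoeff N K
  prime∣lucasCoeff p-prime rewrite ℕP.+-comm N 1
    with euclidsLemma (suc s) (lucasCoeff N K) p-prime (divides (n C K) (trans lucasCoeff-ratio (ℕP.*-comm (suc N) (n C K))))
  ... | inj₂ p∣e   = p∣e
  ... | inj₁ p∣1+s = ⊥-elim (ℕP.<⇒≱ 1+s<p (∣⇒≤ p∣1+s))
    where
    1+s<p : suc s < suc N
    1+s<p = s≤s (s≤s (ℕP.≤-trans (ℕP.m≤n+m s K) (ℕP.m≤n+m n k)))

  binomial-ratio : (1ℚ ⊘ ⟦ N + 1 ∸ 2 * K ⟧) *ℚ ⟦ (N + 1 ∸ K ∸ 1) C K ⟧ ≡ (1ℚ ⊘ ⟦ N + 1 ⟧) *ℚ ⟦ lucasCoeff N K ⟧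
  binomial-ratio = begin
    (1ℚ ⊘ ⟦ N + 1 ∸ 2 * K ⟧) *ℚ ⟦ (N + 1 ∸ K ∸ 1) C K ⟧
      ≡⟨ cong₂ (λ x y → (1ℚ ⊘ ⟦ x ⟧) *ℚ ⟦ y C K ⟧) N+1∸2K≡1+s N+1∸K∸1≡n ⟩
    (1ℚ ⊘ ⟦ suc s ⟧) *ℚ ⟦ n C K ⟧
      ≡⟨ ⊘-cross (suc s) (N + 1) (n C K) (lucasCoeff N K) (λ ()) (ℕP.m+1+n≢0 N)
                 (trans lucasCoeff-ratio (cong (_* (n C K)) (ℕP.+-comm 1 N))) ⟩
    (1ℚ ⊘ ⟦ N + 1 ⟧) *ℚ ⟦ lucasCoeff N K ⟧ ∎
    where
    open ≡-Reasoning
    N+1∸2K≡1+s : N + 1 ∸ 2 * K ≡ suc s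
    N+1∸2K≡1+s = trans (cong (_∸ 2 * K) (split k s)) (ℕP.m+n∸m≡n (2 * K) (suc s))
      where
      split : ∀ k s → suc k + (suc k + s) + 1 ≡ 2 * suc k + suc s
      split = solve-∀
    N+1∸K∸1≡n : N + 1 ∸ K ∸ 1 ≡ n
    N+1∸K∸1≡n = cong (_∸ 1) (trans (cong (_∸ K) (split k s)) (ℕP.m+n∸m≡n K (suc n)))
      where
      split : ∀ k s → suc k + (suc k + s) + 1 ≡ suc k + suc (suc k + s)
      split = solve-∀

-- Rising factorials and the hypergeometric coefficients

rising-neg : ∀ k s → rising (- ⟦ k + s ⟧) k *ℚ ⟦ s ! ⟧ ≡ (- 1ℚ) ^ℚ k *ℚ ⟦ (k + s) ! ⟧
rising-neg zero    s = refl
rising-neg (suc k) s = begin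
  rising (- ⟦ suc k + s ⟧) (suc k) *ℚ ⟦ s ! ⟧
    ≡⟨ cong (λ x → rising (- ⟦ x ⟧) (suc k) *ℚ ⟦ s ! ⟧) (sym (ℕP.+-suc k s)) ⟩
  (Z *ℚ (- M +ℚ ⟦ k ⟧)) *ℚ ⟦ s ! ⟧
    ≡⟨ cong (λ x → (Z *ℚ (- x +ℚ ⟦ k ⟧)) *ℚ ⟦ s ! ⟧) M≡k+1+s ⟩
  (Z *ℚ (- (⟦ k ⟧ +ℚ (1ℚ +ℚ ⟦ s ⟧)) +ℚ ⟦ k ⟧)) *ℚ ⟦ s ! ⟧
    ≡⟨ peel Z ⟦ k ⟧ ⟦ s ⟧ ⟦ s ! ⟧ ⟩
  (- 1ℚ) *ℚ (Z *ℚ ((1ℚ +ℚ ⟦ s ⟧) *ℚ ⟦ s ! ⟧))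
    ≡⟨ cong (λ x → (- 1ℚ) *ℚ (Z *ℚ x)) (sym (trans (⟦⟧-homo-* (suc s) (s !)) (cong (_*ℚ ⟦ s ! ⟧) (⟦⟧-homo-+ 1 s)))) ⟩
  (- 1ℚ) *ℚ (Z *ℚ ⟦ (suc s) ! ⟧)
    ≡⟨ cong ((- 1ℚ) *ℚ_) (rising-neg k (suc s)) ⟩
  (- 1ℚ) *ℚ ((- 1ℚ) ^ℚ k *ℚ ⟦ (k + suc s) ! ⟧)
    ≡⟨ sym (ℚP.*-assoc (- 1ℚ) ((- 1ℚ) ^ℚ k) ⟦ (k + suc s) ! ⟧) ⟩
  (- 1ℚ) ^ℚ suc k *ℚ ⟦ (k + suc s) ! ⟧
    ≡⟨ cong (λ x → (- 1ℚ) ^ℚ suc k *ℚ ⟦ x ! ⟧) (ℕP.+-suc k s) ⟩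
  (- 1ℚ) ^ℚ suc k *ℚ ⟦ (suc k + s) ! ⟧ ∎
  where
  open ≡-Reasoning
  M Z : ℚ
  M = ⟦ k + suc s ⟧
  Z = rising (- M) k
  M≡k+1+s : M ≡ ⟦ k ⟧ +ℚ (1ℚ +ℚ ⟦ s ⟧)
  M≡k+1+s = trans (⟦⟧-homo-+ k (suc s)) (cong (⟦ k ⟧ +ℚ_) (⟦⟧-homo-+ 1 s))
  peel : ∀ Z K S F → (Z *ℚ (- (K +ℚ (1ℚ +ℚ S)) +ℚ K)) *ℚ F ≡ (- 1ℚ) *ℚ (Z *ℚ ((1ℚ +ℚ S) *ℚ F))
  peel = ℚ-Solver.solve-∀ ℚ-ring

rising-duplication : ∀ k r → let M = ⟦ k + r ⟧ in
  rising (- M - ½) k *ℚ rising (- M) k *ℚ (- ⟦ 4 ⟧) ^ℚ k *ℚ ⟦ (suc (2 * r)) ! ⟧ ≡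
  (- 1ℚ) ^ℚ k *ℚ ⟦ (2 * (k + r) + 1) ! ⟧
rising-duplication zero    r = trans (unit ⟦ (suc (2 * r)) ! ⟧) (cong (λ x → 1ℚ *ℚ ⟦ x ! ⟧) (ℕP.+-comm 1 (2 * r)))
  where
  unit : ∀ x → 1ℚ *ℚ 1ℚ *ℚ 1ℚ *ℚ x ≡ 1ℚ *ℚ x
  unit = ℚ-Solver.solve-∀ ℚ-ring
rising-duplication (suc k) r = begin
  rising (- ⟦ suc k + r ⟧ - ½) (suc k) *ℚ rising (- ⟦ suc k + r ⟧) (suc k) *ℚ (- ⟦ 4 ⟧) ^ℚ suc k *ℚ F
    ≡⟨ cong (λ x → rising (- ⟦ x ⟧ - ½) (suc k) *ℚ rising (- ⟦ x ⟧) (suc k) *ℚ (- ⟦ 4 ⟧) ^ℚ suc k *ℚ F)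
            (sym (ℕP.+-suc k r)) ⟩
  (X *ℚ (- M - ½ +ℚ ⟦ k ⟧)) *ℚ (Y *ℚ (- M +ℚ ⟦ k ⟧)) *ℚ ((- ⟦ 4 ⟧) *ℚ W) *ℚ F
    ≡⟨ cong (λ x → (X *ℚ (- x - ½ +ℚ ⟦ k ⟧)) *ℚ (Y *ℚ (- x +ℚ ⟦ k ⟧)) *ℚ ((- ⟦ 4 ⟧) *ℚ W) *ℚ F) M≡k+1+r ⟩
  (X *ℚ (- (⟦ k ⟧ +ℚ (1ℚ +ℚ R)) - ½ +ℚ ⟦ k ⟧)) *ℚ (Y *ℚ (- (⟦ k ⟧ +ℚ (1ℚ +ℚ R)) +ℚ ⟦ k ⟧)) *ℚ ((- ⟦ 4 ⟧) *ℚ W) *ℚ F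
    ≡⟨ peel X Y W F ⟦ k ⟧ R ⟩
  (- 1ℚ) *ℚ (X *ℚ Y *ℚ W *ℚ ((⟦ 3 ⟧ +ℚ ⟦ 2 ⟧ *ℚ R) *ℚ ((⟦ 2 ⟧ +ℚ ⟦ 2 ⟧ *ℚ R) *ℚ F)))
    ≡⟨ cong (λ x → (- 1ℚ) *ℚ (X *ℚ Y *ℚ W *ℚ x)) (sym two-more-factors) ⟩
  (- 1ℚ) *ℚ (X *ℚ Y *ℚ W *ℚ ⟦ (suc (2 * suc r)) ! ⟧)
    ≡⟨ cong ((- 1ℚ) *ℚ_) (rising-duplication k (suc r)) ⟩
  (- 1ℚ) *ℚ ((- 1ℚ) ^ℚ k *ℚ ⟦ (2 * (k + suc r) + 1) ! ⟧)
    ≡⟨ sym (ℚP.*-assoc (- 1ℚ) ((- 1ℚ) ^ℚ k) ⟦ (2 * (k + suc r) + 1) ! ⟧) ⟩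
  (- 1ℚ) ^ℚ suc k *ℚ ⟦ (2 * (k + suc r) + 1) ! ⟧
    ≡⟨ cong (λ x → (- 1ℚ) ^ℚ suc k *ℚ ⟦ (2 * x + 1) ! ⟧) (ℕP.+-suc k r) ⟩
  (- 1ℚ) ^ℚ suc k *ℚ ⟦ (2 * (suc k + r) + 1) ! ⟧ ∎
  where
  open ≡-Reasoning
  F M R X Y W : ℚ
  F = ⟦ (suc (2 * r)) ! ⟧
  M = ⟦ k + suc r ⟧
  R = ⟦ r ⟧
  X = rising (- M - ½) k
  Y = rising (- M) k
  W = (- ⟦ 4 ⟧) ^ℚ k
  M≡k+1+r : M ≡ ⟦ k ⟧ +ℚ (1ℚ +ℚ R)
  M≡k+1+r = trans (⟦⟧-homo-+ k (suc r)) (cong (⟦ k ⟧ +ℚ_) (⟦⟧-homo-+ 1 r))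
  peel : ∀ X Y W F K R →
    (X *ℚ (- (K +ℚ (1ℚ +ℚ R)) - ½ +ℚ K)) *ℚ (Y *ℚ (- (K +ℚ (1ℚ +ℚ R)) +ℚ K)) *ℚ ((- ⟦ 4 ⟧) *ℚ W) *ℚ F ≡
    (- 1ℚ) *ℚ (X *ℚ Y *ℚ W *ℚ ((⟦ 3 ⟧ +ℚ ⟦ 2 ⟧ *ℚ R) *ℚ ((⟦ 2 ⟧ +ℚ ⟦ 2 ⟧ *ℚ R) *ℚ F)))
  peel = ℚ-Solver.solve-∀ ℚ-ring
  two-more-factors : ⟦ (suc (2 * suc r)) ! ⟧ ≡
    (⟦ 3 ⟧ +ℚ ⟦ 2 ⟧ *ℚ R) *ℚ ((⟦ 2 ⟧ +ℚ ⟦ 2 ⟧ *ℚ R) *ℚ F)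
  two-more-factors = begin
    ⟦ (suc (2 * suc r)) ! ⟧
      ≡⟨ cong (λ x → ⟦ x ! ⟧) (2[1+r]+1≡3+2r r) ⟩
    ⟦ suc (suc (suc (2 * r))) * (suc (suc (2 * r)) * (suc (2 * r)) !) ⟧
      ≡⟨ trans (⟦⟧-homo-* (3 + 2 * r) ((2 + 2 * r) * (suc (2 * r)) !)) (cong (⟦ 3 + 2 * r ⟧ *ℚ_) (⟦⟧-homo-* (2 + 2 * r) ((suc (2 * r)) !))) ⟩
    ⟦ 3 + 2 * r ⟧ *ℚ (⟦ 2 + 2 * r ⟧ *ℚ F)
      ≡⟨ cong₂ (λ x y → x *ℚ (y *ℚ F)) (⟦2r+i⟧ 3) (⟦2r+i⟧ 2) ⟩
    (⟦ 3 ⟧ +ℚ ⟦ 2 ⟧ *ℚ R) *ℚ ((⟦ 2 ⟧ +ℚ ⟦ 2 ⟧ *ℚ R) *ℚ F) ∎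
    where
    2[1+r]+1≡3+2r : ∀ r → suc (2 * suc r) ≡ 3 + 2 * r
    2[1+r]+1≡3+2r = solve-∀
    ⟦2r+i⟧ : ∀ i → ⟦ i + 2 * r ⟧ ≡ ⟦ i ⟧ +ℚ ⟦ 2 ⟧ *ℚ R
    ⟦2r+i⟧ i = trans (⟦⟧-homo-+ i (2 * r)) (cong (⟦ i ⟧ +ℚ_) (⟦⟧-homo-* 2 r))

2[k+r]≡k+[k+2r] : ∀ k r → 2 * (suc k + r) ≡ suc k + (suc k + 2 * r)
2[k+r]≡k+[k+2r] = solve-∀

module _ (k r : ℕ) where
  private
    K m n N : ℕ
    K = suc k
    m = K + r
    n = K + 2 * r
    N = K + n
    X W : ℚ
    X = rising (- ⟦ m ⟧ - ½) K *ℚ rising (- ⟦ m ⟧) K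
    W = (- ⟦ 4 ⟧) ^ℚ K

  hypergeometric-coeff :
    (rising (- ⟦ m ⟧ - ½) K *ℚ rising (- ⟦ m ⟧) K) ⊘ (rising (- ⟦ 2 * m ⟧) K *ℚ ⟦ K ! ⟧) *ℚ (- ⟦ 4 ⟧) ^ℚ K
      ≡ ⟦ lucasCoeff (2 * m) K ⟧
  hypergeometric-coeff =
    subst (λ x → X ⊘ (rising (- ⟦ x ⟧) K *ℚ ⟦ K ! ⟧) *ℚ W ≡ ⟦ lucasCoeff x K ⟧) (sym (2[k+r]≡k+[k+2r] k r)) (begin
      X ⊘ Y *ℚ W     ≡⟨ ⊘-*-comm X Y W ⟩
      (X *ℚ W) ⊘ Y   ≡⟨ x≡z*y⇒x⊘y≡z (X *ℚ W) Y ⟦ e ⟧ Y≢0 X*W≡e*Y ⟩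
      ⟦ e ⟧          ∎)
    where
    open ≡-Reasoning
    e : ℕ
    e = lucasCoeff N K
    G Y sg U V : ℚ
    G = rising (- ⟦ N ⟧) K
    Y = G *ℚ ⟦ K ! ⟧
    sg = (- 1ℚ) ^ℚ K
    U = ⟦ (suc (2 * r)) ! ⟧
    V = ⟦ n ! ⟧
    2m+1≡1+N : ∀ k r → 2 * (suc k + r) + 1 ≡ suc (suc k + (suc k + 2 * r))
    2m+1≡1+N = solve-∀

    sg≢0 : sg ≢ 0ℚ
    sg≢0 = x^k≢0 (- 1ℚ) K (λ ())

    G*V : G *ℚ V ≡ sg *ℚ ⟦ N ! ⟧
    G*V = rising-neg K n

    X*W*U : X *ℚ W *ℚ U ≡ sg *ℚ ⟦ (suc N) ! ⟧
    X*W*U = subst (λ x → X *ℚ W *ℚ U ≡ sg *ℚ ⟦ x ! ⟧) (2m+1≡1+N k r) (rising-duplication K r)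

    Y≢0 : Y ≢ 0ℚ
    Y≢0 = x*y≢0 G ⟦ K ! ⟧ G≢0 (⟦n!⟧≢0 K)
      where
      G≢0 : G ≢ 0ℚ
      G≢0 G≡0 = x*y≢0 sg ⟦ N ! ⟧ sg≢0 (⟦n!⟧≢0 N)
                  (trans (sym G*V) (trans (cong (_*ℚ V) G≡0) (ℚP.*-zeroˡ V)))

    factorials : (suc N) ! * n ! ≡ e * ((suc (2 * r)) ! * N ! * K !)
    factorials = begin
      suc N * N ! * n !                        ≡⟨ swap₂₃ (suc N) (N !) (n !) ⟩
      suc N * n ! * N !                        ≡⟨ cong (_* N !) (sym (lucasCoeff-factorial k (2 * r))) ⟩
      e * (K ! * (suc (2 * r)) !) * N !        ≡⟨ reorder e (K !) ((suc (2 * r)) !) (N !) ⟩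
      e * ((suc (2 * r)) ! * N ! * K !)        ∎
      where
      swap₂₃ : ∀ a b c → a * b * c ≡ a * c * b
      swap₂₃ = solve-∀
      reorder : ∀ e f g h → e * (f * g) * h ≡ e * (g * h * f)
      reorder = solve-∀

    ⟦factorials⟧ : ⟦ (suc N) ! ⟧ *ℚ V ≡ ⟦ e ⟧ *ℚ (U *ℚ ⟦ N ! ⟧ *ℚ ⟦ K ! ⟧)
    ⟦factorials⟧ = begin
      ⟦ (suc N) ! ⟧ *ℚ V                          ≡⟨ sym (⟦⟧-homo-* ((suc N) !) (n !)) ⟩
      ⟦ (suc N) ! * n ! ⟧                         ≡⟨ cong ⟦_⟧ factorials ⟩
      ⟦ e * ((suc (2 * r)) ! * N ! * K !) ⟧       ≡⟨ ⟦⟧-homo-* e ((suc (2 * r)) ! * N ! * K !) ⟩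
      ⟦ e ⟧ *ℚ ⟦ (suc (2 * r)) ! * N ! * K ! ⟧    ≡⟨ cong (⟦ e ⟧ *ℚ_) (trans (⟦⟧-homo-* ((suc (2 * r)) ! * N !) (K !))
                                                        (cong (_*ℚ ⟦ K ! ⟧) (⟦⟧-homo-* ((suc (2 * r)) !) (N !)))) ⟩
      ⟦ e ⟧ *ℚ (U *ℚ ⟦ N ! ⟧ *ℚ ⟦ K ! ⟧)          ∎

    X*W≡e*Y : X *ℚ W ≡ ⟦ e ⟧ *ℚ Y
    X*W≡e*Y = *-cancelʳ-≡ (X *ℚ W) (⟦ e ⟧ *ℚ Y) (U *ℚ V) (x*y≢0 U V (⟦n!⟧≢0 (suc (2 * r))) (⟦n!⟧≢0 n)) (begin
      X *ℚ W *ℚ (U *ℚ V)                         ≡⟨ sym (ℚP.*-assoc (X *ℚ W) U V) ⟩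
      X *ℚ W *ℚ U *ℚ V                           ≡⟨ cong (_*ℚ V) X*W*U ⟩
      sg *ℚ ⟦ (suc N) ! ⟧ *ℚ V                   ≡⟨ ℚP.*-assoc sg ⟦ (suc N) ! ⟧ V ⟩
      sg *ℚ (⟦ (suc N) ! ⟧ *ℚ V)                 ≡⟨ cong (sg *ℚ_) ⟦factorials⟧ ⟩
      sg *ℚ (⟦ e ⟧ *ℚ (U *ℚ ⟦ N ! ⟧ *ℚ ⟦ K ! ⟧)) ≡⟨ regroup sg ⟦ e ⟧ U ⟦ N ! ⟧ ⟦ K ! ⟧ ⟩
      ⟦ e ⟧ *ℚ ⟦ K ! ⟧ *ℚ U *ℚ (sg *ℚ ⟦ N ! ⟧)   ≡⟨ cong (⟦ e ⟧ *ℚ ⟦ K ! ⟧ *ℚ U *ℚ_) (sym G*V) ⟩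
      ⟦ e ⟧ *ℚ ⟦ K ! ⟧ *ℚ U *ℚ (G *ℚ V)          ≡⟨ regroup′ ⟦ e ⟧ ⟦ K ! ⟧ U G V ⟩
      ⟦ e ⟧ *ℚ Y *ℚ (U *ℚ V)                     ∎)
      where
      regroup : ∀ sg e U T k → sg *ℚ (e *ℚ (U *ℚ T *ℚ k)) ≡ e *ℚ k *ℚ U *ℚ (sg *ℚ T)
      regroup = ℚ-Solver.solve-∀ ℚ-ring
      regroup′ : ∀ e k U g V → e *ℚ k *ℚ U *ℚ (g *ℚ V) ≡ e *ℚ (g *ℚ k) *ℚ (U *ℚ V)
      regroup′ = ℚ-Solver.solve-∀ ℚ-ring

-- The Fermat quotient

data Within : ℕ → ℕ → Set where
  within : ∀ k r → Within (suc k) (suc k + r)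

within? : ∀ {k m} → 1 ≤ k → k ≤ m → Within k m
within? {suc k} {m} (s≤s z≤n) k≤m with m ∸ suc k | ℕP.m+[n∸m]≡n k≤m
... | r | refl = within k r

prime∣lucasCoeff-2m : ∀ m k → Prime (2 * m + 1) → 1 ≤ k → k ≤ m → 2 * m + 1 ∣ lucasCoeff (2 * m) k
prime∣lucasCoeff-2m m k p-prime 1≤k k≤m with within? 1≤k k≤m
... | within k r =
  subst (λ x → Prime (x + 1) → x + 1 ∣ lucasCoeff x (suc k)) (sym (2[k+r]≡k+[k+2r] k r)) (prime∣lucasCoeff k (2 * r)) p-prime

binomial-ratio-2m : ∀ m k → 1 ≤ k → k ≤ m →
  (1ℚ ⊘ ⟦ 2 * m + 1 ∸ 2 * k ⟧) *ℚ ⟦ (2 * m + 1 ∸ k ∸ 1) C k ⟧ ≡ (1ℚ ⊘ ⟦ 2 * m + 1 ⟧) *ℚ ⟦ lucasCoeff (2 * m) k ⟧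
binomial-ratio-2m m k 1≤k k≤m with within? 1≤k k≤m
... | within k r =
  subst (λ x → (1ℚ ⊘ ⟦ x + 1 ∸ 2 * suc k ⟧) *ℚ ⟦ (x + 1 ∸ suc k ∸ 1) C suc k ⟧ ≡
               (1ℚ ⊘ ⟦ x + 1 ⟧) *ℚ ⟦ lucasCoeff x (suc k) ⟧)
        (sym (2[k+r]≡k+[k+2r] k r)) (binomial-ratio k (2 * r))

hypergeometric-coeff-2m : ∀ m k → 1 ≤ k → k ≤ m →
  (rising (- ⟦ m ⟧ - ½) k *ℚ rising (- ⟦ m ⟧) k) ⊘ (rising (- ⟦ 2 * m ⟧) k *ℚ ⟦ k ! ⟧) *ℚ (- ⟦ 4 ⟧) ^ℚ k
    ≡ ⟦ lucasCoeff (2 * m) k ⟧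
hypergeometric-coeff-2m m k 1≤k k≤m with within? 1≤k k≤m
... | within k r = hypergeometric-coeff k r

hypergeometric-term : ∀ m j k → 1 ≤ k → k ≤ m →
  (rising (- ⟦ m ⟧ - ½) k *ℚ rising (- ⟦ m ⟧) k) ⊘ (rising (- ⟦ 2 * m ⟧) k *ℚ ⟦ k ! ⟧)
    *ℚ (- (⟦ 4 ⟧ *ℚ ⟦ j ⟧ *ℚ ⟦ j + 1 ⟧)) ^ℚ k ≡ ⟦ lucasCoeff (2 * m) k * (j * (j + 1)) ^ k ⟧
hypergeometric-term m j k 1≤k k≤m = begin
  c *ℚ (- (⟦ 4 ⟧ *ℚ ⟦ j ⟧ *ℚ ⟦ j + 1 ⟧)) ^ℚ k ≡⟨ cong (λ x → c *ℚ x ^ℚ k) -4P ⟩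
  c *ℚ ((- ⟦ 4 ⟧) *ℚ ⟦ P ⟧) ^ℚ k              ≡⟨ cong (c *ℚ_) (^ℚ-distribʳ-* (- ⟦ 4 ⟧) ⟦ P ⟧ k) ⟩
  c *ℚ ((- ⟦ 4 ⟧) ^ℚ k *ℚ ⟦ P ⟧ ^ℚ k)         ≡⟨ sym (ℚP.*-assoc c ((- ⟦ 4 ⟧) ^ℚ k) (⟦ P ⟧ ^ℚ k)) ⟩
  c *ℚ (- ⟦ 4 ⟧) ^ℚ k *ℚ ⟦ P ⟧ ^ℚ k           ≡⟨ cong₂ _*ℚ_ (hypergeometric-coeff-2m m k 1≤k k≤m) (sym (⟦⟧-homo-^ P k)) ⟩
  ⟦ e ⟧ *ℚ ⟦ P ^ k ⟧                          ≡⟨ sym (⟦⟧-homo-* e (P ^ k)) ⟩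
  ⟦ e * P ^ k ⟧                               ∎
  where
  open ≡-Reasoning
  P e : ℕ
  P = j * (j + 1)
  e = lucasCoeff (2 * m) k
  c : ℚ
  c = (rising (- ⟦ m ⟧ - ½) k *ℚ rising (- ⟦ m ⟧) k) ⊘ (rising (- ⟦ 2 * m ⟧) k *ℚ ⟦ k ! ⟧)
  factor : ∀ a b c → - (a *ℚ b *ℚ c) ≡ (- a) *ℚ (b *ℚ c)
  factor = ℚ-Solver.solve-∀ ℚ-ring
  -4P : - (⟦ 4 ⟧ *ℚ ⟦ j ⟧ *ℚ ⟦ j + 1 ⟧) ≡ (- ⟦ 4 ⟧) *ℚ ⟦ P ⟧
  -4P = trans (factor ⟦ 4 ⟧ ⟦ j ⟧ ⟦ j + 1 ⟧) (cong ((- ⟦ 4 ⟧) *ℚ_) (sym (⟦⟧-homo-* j (j + 1))))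

Δ-hypergeometric : ∀ m j →
  ₂F₁[ - ⟦ m ⟧ - ½ , - ⟦ m ⟧ , - ⟦ 2 * m ⟧ ]-upTo m at (- (⟦ 4 ⟧ *ℚ ⟦ j ⟧ *ℚ ⟦ j + 1 ⟧)) - 1ℚ ≡ ⟦ Δ m j ⟧
Δ-hypergeometric m j = begin
  1ℚ +ℚ Σ₁ m t - 1ℚ                                          ≡⟨ cancel (Σ₁ m t) ⟩
  Σ₁ m t                                                     ≡⟨ Σ₁-cong m (hypergeometric-term m j) ⟩
  Σ₁ m (λ k → ⟦ lucasCoeff (2 * m) k * (j * (j + 1)) ^ k ⟧)  ≡⟨ Σ₁-⟦⟧ m _ ⟩
  ⟦ Δ m j ⟧                                                  ∎
  where
  open ≡-Reasoning
  t : ℕ → ℚ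
  t k = (rising (- ⟦ m ⟧ - ½) k *ℚ rising (- ⟦ m ⟧) k) ⊘ (rising (- ⟦ 2 * m ⟧) k *ℚ ⟦ k ! ⟧)
          *ℚ (- (⟦ 4 ⟧ *ℚ ⟦ j ⟧ *ℚ ⟦ j + 1 ⟧)) ^ℚ k
  cancel : ∀ x → 1ℚ +ℚ x - 1ℚ ≡ x
  cancel = ℚ-Solver.solve-∀ ℚ-ring

Δ-binomial : ∀ m J →
  Σ₁ m (λ k → (1ℚ ⊘ ⟦ 2 * m + 1 ∸ 2 * k ⟧) *ℚ ⟦ (2 * m + 1 ∸ k ∸ 1) C k ⟧
               *ℚ Σ₁ J (λ j → ⟦ j ⟧ ^ℚ k *ℚ ⟦ j + 1 ⟧ ^ℚ k))
    ≡ (1ℚ ⊘ ⟦ 2 * m + 1 ⟧) *ℚ ⟦ sum₁ J (Δ m) ⟧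
Δ-binomial m J = begin
  Σ₁ m (λ k → (1ℚ ⊘ ⟦ 2 * m + 1 ∸ 2 * k ⟧) *ℚ ⟦ (2 * m + 1 ∸ k ∸ 1) C k ⟧
               *ℚ Σ₁ J (λ j → ⟦ j ⟧ ^ℚ k *ℚ ⟦ j + 1 ⟧ ^ℚ k))  ≡⟨ Σ₁-cong m term ⟩
  Σ₁ m (λ k → v *ℚ ⟦ f k ⟧)                                   ≡⟨ Σ₁-*ˡ m v (λ k → ⟦ f k ⟧) ⟩
  v *ℚ Σ₁ m (λ k → ⟦ f k ⟧)                                   ≡⟨ cong (v *ℚ_) (Σ₁-⟦⟧ m f) ⟩
  v *ℚ ⟦ sum₁ m f ⟧                                           ≡⟨ cong (λ x → v *ℚ ⟦ x ⟧) swap ⟩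
  v *ℚ ⟦ sum₁ J (Δ m) ⟧                                       ∎
  where
  open ≡-Reasoning
  v : ℚ
  v = 1ℚ ⊘ ⟦ 2 * m + 1 ⟧
  f : ℕ → ℕ
  f k = lucasCoeff (2 * m) k * sum₁ J (λ j → (j * (j + 1)) ^ k)
  power-sum : ∀ k → Σ₁ J (λ j → ⟦ j ⟧ ^ℚ k *ℚ ⟦ j + 1 ⟧ ^ℚ k) ≡ ⟦ sum₁ J (λ j → (j * (j + 1)) ^ k) ⟧
  power-sum k = trans (Σ₁-cong J (λ j _ _ → sym (trans (⟦⟧-homo-^ (j * (j + 1)) k)
                        (trans (cong (_^ℚ k) (⟦⟧-homo-* j (j + 1))) (^ℚ-distribʳ-* ⟦ j ⟧ ⟦ j + 1 ⟧ k)))))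
                      (Σ₁-⟦⟧ J (λ j → (j * (j + 1)) ^ k))
  term : ∀ k → 1 ≤ k → k ≤ m → (1ℚ ⊘ ⟦ 2 * m + 1 ∸ 2 * k ⟧) *ℚ ⟦ (2 * m + 1 ∸ k ∸ 1) C k ⟧
                                 *ℚ Σ₁ J (λ j → ⟦ j ⟧ ^ℚ k *ℚ ⟦ j + 1 ⟧ ^ℚ k) ≡ v *ℚ ⟦ f k ⟧
  term k 1≤k k≤m = trans (cong₂ _*ℚ_ (binomial-ratio-2m m k 1≤k k≤m) (power-sum k))
                         (trans (ℚP.*-assoc v _ _) (cong (v *ℚ_) (sym (⟦⟧-homo-* (lucasCoeff (2 * m) k) _))))
  swap : sum₁ m f ≡ sum₁ J (Δ m)
  swap = trans (sum₁-cong m (λ k _ _ → sym (sum₁-*ˡ J (lucasCoeff (2 * m) k) (λ j → (j * (j + 1)) ^ k))))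
               (sym (sum₁-comm J m (λ j k → lucasCoeff (2 * m) k * (j * (j + 1)) ^ k)))

sum-Δ≡a*[a^2m∸1] : ∀ m J → sum₁ J (Δ m) ≡ suc J * (suc J ^ (2 * m) ∸ 1)
sum-Δ≡a*[a^2m∸1] m J = ℕP.+-cancelʳ-≡ a (sum₁ J (Δ m)) (a * (b ∸ 1)) (begin
  sum₁ J (Δ m) + a        ≡⟨ telescope m J ⟩
  a ^ (2 * m + 1)         ≡⟨ cong (a ^_) (ℕP.+-comm (2 * m) 1) ⟩
  a * b                   ≡⟨ cong (a *_) (sym (ℕP.m+[n∸m]≡n (ℕP.m^n>0 a (2 * m)))) ⟩
  a * (1 + (b ∸ 1))       ≡⟨ ℕP.*-suc a (b ∸ 1) ⟩
  a + a * (b ∸ 1)         ≡⟨ ℕP.+-comm a (a * (b ∸ 1)) ⟩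
  a * (b ∸ 1) + a         ∎)
  where
  open ≡-Reasoning
  a b : ℕ
  a = suc J
  b = a ^ (2 * m)

fermat : ∀ m J → Prime (2 * m + 1) → gcd (suc J) (2 * m + 1) ≡ 1 → 2 * m + 1 ∣ suc J ^ (2 * m) ∸ 1
fermat m J p-prime gcd≡1 with euclidsLemma (suc J) _ p-prime (subst (2 * m + 1 ∣_) (sum-Δ≡a*[a^2m∸1] m J) p∣sum)
  where
  p∣sum : 2 * m + 1 ∣ sum₁ J (Δ m)
  p∣sum = ∣-sum₁ J (Δ m) (λ j _ _ → ∣-sum₁ m _ (λ k 1≤k k≤m →
            ∣m⇒∣m*n ((j * (j + 1)) ^ k) (prime∣lucasCoeff-2m m k p-prime 1≤k k≤m)))
... | inj₂ p∣a^2m∸1 = p∣a^2m∸1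
... | inj₁ p∣a = ⊥-elim (nonTrivial⇒≢1 {{prime⇒nonTrivial p-prime}}
                   (∣1⇒≡1 (subst (2 * m + 1 ∣_) gcd≡1 (gcd-greatest p∣a (∣-refl {2 * m + 1})))))

module _ (m J q : ℕ) (sum-Δ≡q*a*p : sum₁ J (Δ m) ≡ q * suc J * (2 * m + 1)) where
  private
    a p : ℕ
    a = suc J
    p = 2 * m + 1
    p≢0 : p ≢ 0
    p≢0 = ℕP.m+1+n≢0 (2 * m)

  binomial-form : ⟦ q ⟧ ≡ (1ℚ ⊘ ⟦ a ⟧) *ℚ
    Σ₁ m (λ k → (1ℚ ⊘ ⟦ p ∸ 2 * k ⟧) *ℚ ⟦ (p ∸ k ∸ 1) C k ⟧ *ℚ Σ₁ J (λ j → ⟦ j ⟧ ^ℚ k *ℚ ⟦ j + 1 ⟧ ^ℚ k))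
  binomial-form = sym (begin
    (1ℚ ⊘ ⟦ a ⟧) *ℚ Σ₁ m _                          ≡⟨ cong ((1ℚ ⊘ ⟦ a ⟧) *ℚ_) (Δ-binomial m J) ⟩
    (1ℚ ⊘ ⟦ a ⟧) *ℚ ((1ℚ ⊘ ⟦ p ⟧) *ℚ ⟦ sum₁ J (Δ m) ⟧) ≡⟨ cong (λ x → (1ℚ ⊘ ⟦ a ⟧) *ℚ ((1ℚ ⊘ ⟦ p ⟧) *ℚ ⟦ x ⟧)) sum-Δ≡q*a*p ⟩
    (1ℚ ⊘ ⟦ a ⟧) *ℚ ((1ℚ ⊘ ⟦ p ⟧) *ℚ ⟦ q * a * p ⟧)  ≡⟨ cong ((1ℚ ⊘ ⟦ a ⟧) *ℚ_) (1⊘⟦n⟧*⟦m*n⟧≡⟦m⟧ (q * a) p p≢0) ⟩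
    (1ℚ ⊘ ⟦ a ⟧) *ℚ ⟦ q * a ⟧                        ≡⟨ 1⊘⟦n⟧*⟦m*n⟧≡⟦m⟧ q a (λ ()) ⟩
    ⟦ q ⟧                                            ∎)
    where open ≡-Reasoning

  hypergeometric-form : ⟦ q ⟧ ≡ (1ℚ ⊘ (⟦ a ⟧ *ℚ ⟦ p ⟧)) *ℚ
    Σ₁ J (λ j → ₂F₁[ - ⟦ m ⟧ - ½ , - ⟦ m ⟧ , - ⟦ 2 * m ⟧ ]-upTo m at (- (⟦ 4 ⟧ *ℚ ⟦ j ⟧ *ℚ ⟦ j + 1 ⟧)) - 1ℚ)
  hypergeometric-form = sym (begin
    w *ℚ Σ₁ J _                       ≡⟨ cong (w *ℚ_) (trans (Σ₁-cong J (λ j _ _ → Δ-hypergeometric m j)) (Σ₁-⟦⟧ J (Δ m))) ⟩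
    w *ℚ ⟦ sum₁ J (Δ m) ⟧             ≡⟨ cong (λ x → w *ℚ ⟦ x ⟧) (trans sum-Δ≡q*a*p (ℕP.*-assoc q a p)) ⟩
    w *ℚ ⟦ q * (a * p) ⟧              ≡⟨ cong (w *ℚ_) (trans (⟦⟧-homo-* q (a * p)) (cong (⟦ q ⟧ *ℚ_) (⟦⟧-homo-* a p))) ⟩
    w *ℚ (⟦ q ⟧ *ℚ (⟦ a ⟧ *ℚ ⟦ p ⟧))  ≡⟨ 1⊘y*[z*y]≡z (⟦ a ⟧ *ℚ ⟦ p ⟧) ⟦ q ⟧ (x*y≢0 ⟦ a ⟧ ⟦ p ⟧ (⟦⟧-≢0 {a} (λ ())) (⟦⟧-≢0 p≢0)) ⟩
    ⟦ q ⟧                             ∎)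
    where
    open ≡-Reasoning
    w : ℚ
    w = 1ℚ ⊘ (⟦ a ⟧ *ℚ ⟦ p ⟧)

corollary1 : (m a : ℕ) → Prime (2 * m + 1) → a ≥ 1 → gcd a (2 * m + 1) ≡ 1 →
    ∃ λ (q : ℕ) →
      (a ^ (2 * m + 1 ∸ 1) ≡ q * (2 * m + 1) + 1)
      × (⟦ q ⟧ ≡ ⟦ a ^ (2 * m + 1 ∸ 1) ∸ 1 ⟧ ⊘ ⟦ 2 * m + 1 ⟧)
      × (⟦ q ⟧ ≡ (1ℚ ⊘ ⟦ a ⟧) *ℚ
            Σ₁ m (λ k → (1ℚ ⊘ ⟦ 2 * m + 1 ∸ 2 * k ⟧) *ℚ ⟦ (2 * m + 1 ∸ k ∸ 1) C k ⟧
                         *ℚ Σ₁ (a ∸ 1) (λ j → ⟦ j ⟧ ^ℚ k *ℚ ⟦ j + 1 ⟧ ^ℚ k)))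
      × (⟦ q ⟧ ≡ (1ℚ ⊘ (⟦ a ⟧ *ℚ ⟦ 2 * m + 1 ⟧)) *ℚ
            Σ₁ (a ∸ 1) (λ j →
              ₂F₁[ - ⟦ m ⟧ - ½ , - ⟦ m ⟧ , - ⟦ 2 * m ⟧ ]-upTo m at (- (⟦ 4 ⟧ *ℚ ⟦ j ⟧ *ℚ ⟦ j + 1 ⟧))
              - 1ℚ))
corollary1 m zero    _     ()
corollary1 m (suc J) p-prime _  gcd≡1 =
  q , a^[p∸1]≡q*p+1 , q≡[a^[p∸1]∸1]⊘p , binomial-form m J q sum-Δ≡q*a*p , hypergeometric-form m J q sum-Δ≡q*a*p
  where
  a p : ℕ
  a = suc J
  p = 2 * m + 1
  open _∣_ (fermat m J p-prime gcd≡1) renaming (quotient to q; equality to a^2m∸1≡q*p)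
  a^[p∸1]≡a^2m : a ^ (p ∸ 1) ≡ a ^ (2 * m)
  a^[p∸1]≡a^2m = cong (a ^_) (ℕP.m+n∸n≡m (2 * m) 1)
  a^[p∸1]≡q*p+1 : a ^ (p ∸ 1) ≡ q * p + 1
  a^[p∸1]≡q*p+1 = trans a^[p∸1]≡a^2m (trans (sym (ℕP.m∸n+n≡m (ℕP.m^n>0 a (2 * m)))) (cong (_+ 1) a^2m∸1≡q*p))
  q≡[a^[p∸1]∸1]⊘p : ⟦ q ⟧ ≡ ⟦ a ^ (p ∸ 1) ∸ 1 ⟧ ⊘ ⟦ p ⟧
  q≡[a^[p∸1]∸1]⊘p = sym (x≡z*y⇒x⊘y≡z _ ⟦ p ⟧ ⟦ q ⟧ (⟦⟧-≢0 (ℕP.m+1+n≢0 (2 * m)))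
    (trans (cong (λ x → ⟦ x ∸ 1 ⟧) a^[p∸1]≡a^2m) (trans (cong ⟦_⟧ a^2m∸1≡q*p) (⟦⟧-homo-* q p))))
  sum-Δ≡q*a*p : sum₁ J (Δ m) ≡ q * a * p
  sum-Δ≡q*a*p = trans (sum-Δ≡a*[a^2m∸1] m J) (trans (cong (a *_) a^2m∸1≡q*p) (rearrange a q p))
    where
    rearrange : ∀ a q p → a * (q * p) ≡ q * a * p
    rearrange = solve-∀
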